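{- Let $\mathcal{R}$ be a commutative Frobenius ring of characteristic $2$, let $n\ge1$, and let $A$ and $B$ be $n\times n$ circulant matrices over $\mathcal{R}$ such that the code of length $4n$ generated by the rows of $$\left( I_{2n}\ \middle|\ \begin{array}{cc} A & B \\ B^{T} & A^{T}\end{array}\right)$$ is self-dual. Then for any $n\times n$ reverse circulant matrix $C$ over $\mathcal{R}$ which satisfies $AC=CA$ and $C^{2}=0$, the code generated by the rows of $$\left( I_{2n}\ \middle|\ \begin{array}{cc} A & B+C \\ B^{T}+C & A^{T}\end{array}\right)$$ is self-dual.
   Context: A code of length $N$ over $\mathcal{R}$ is an $\mathcal{R}$-submodule of $\mathcal{R}^N$; the code generated by a matrix is the $\mathcal{R}$-submodule spanned by its rows. Duality is with respect to the Euclidean inner product $\langle x,y\rangle=\sum_i x_iy_i$, and a code $\mathcal{C}$ is self-dual if $\mathcal{C}=\mathcal{C}^\perp$. An $n\times n$ matrix is circulant if each row is the right cyclic shift of the previous row (with $\sigma(a_1,\dots,a_n)=(a_n,a_1,\dots,a_{n-1})$, row $i+1$ is $\sigma^{i}$ of the first row); it is reverse circulant if each row is the left cyclic shift of the previous row (row $i+1$ is $\sigma^{ -i}$ of the first row). -}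

module Defs where

open import Level using (Level; _⊔_) renaming (suc to lsuc)
open import Algebra.Bundles using (CommutativeRing)
open import Data.Nat as ℕ using (ℕ; zero; suc)
open import Data.Nat.DivMod using (_%_; m%n<n)
open import Data.Fin as Fin using (Fin; zero; suc; toℕ; fromℕ<; splitAt)
open import Data.Sum using (_⊎_; inj₁; inj₂; [_,_]′)
open import Data.Product using (Σ; ∃; _×_; _,_)
open import Data.List using (List; []; _∷_)
open import Data.List.Relation.Unary.All using (All)
open import Relation.Nullary using (¬_)

-- Cyclic successor / predecessor on Fin n (n = suc k), i.e. j ↦ j+1 mod n, j ↦ j-1 mod n
succMod : ∀ {k} → Fin (suc k) → Fin (suc k)
succMod {k} j = fromℕ< (m%n<n (suc (toℕ j)) (suc k))

predMod : ∀ {k} → Fin (suc k) → Fin (suc k)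
predMod {k} j = fromℕ< (m%n<n (toℕ j ℕ.+ k) (suc k))

module _ {c ℓ} (R : CommutativeRing c ℓ) where
  open CommutativeRing R using (Carrier; _≈_; _+_; _*_; _-_; 0#; 1#)

  Matrix : ℕ → ℕ → Set c
  Matrix m n = Fin m → Fin n → Carrier

  Vector : ℕ → Set c
  Vector n = Fin n → Carrier

  Σ[_] : ∀ {n} → (Fin n → Carrier) → Carrier
  Σ[_] {zero} f = 0#
  Σ[_] {suc n} f = f zero + Σ[_] (λ i → f (suc i))

  _≈ᴹ_ : ∀ {m n} → Matrix m n → Matrix m n → Set ℓ
  M ≈ᴹ N = ∀ i j → M i j ≈ N i j

  _+ᴹ_ : ∀ {m n} → Matrix m n → Matrix m n → Matrix m n
  (M +ᴹ N) i j = M i j + N i j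

  _*ᴹ_ : ∀ {m n p} → Matrix m n → Matrix n p → Matrix m p
  (M *ᴹ N) i j = Σ[ (λ k → M i k * N k j) ]

  transpose : ∀ {m n} → Matrix m n → Matrix n m
  transpose M i j = M j i

  zeroᴹ : ∀ {m n} → Matrix m n
  zeroᴹ i j = 0#

  identity : ∀ n → Matrix n n
  identity n i j with i Fin.≟ j
  ... | Relation.Nullary.yes _ = 1#
  ... | Relation.Nullary.no _ = 0#

  block : ∀ {a b c′ d} → Matrix a c′ → Matrix a d → Matrix b c′ → Matrix b d
        → Matrix (a ℕ.+ b) (c′ ℕ.+ d)
  block {a} {b} {c′} {d} P Q S T i j with splitAt a i | splitAt c′ j
  ... | inj₁ i′ | inj₁ j′ = P i′ j′
  ... | inj₁ i′ | inj₂ j′ = Q i′ j′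
  ... | inj₂ i′ | inj₁ j′ = S i′ j′
  ... | inj₂ i′ | inj₂ j′ = T i′ j′

  hcat : ∀ {m a b} → Matrix m a → Matrix m b → Matrix m (a ℕ.+ b)
  hcat {m} {a} P Q i j with splitAt a j
  ... | inj₁ j′ = P i j′
  ... | inj₂ j′ = Q i j′

  IsCirculant : ∀ {k} → Matrix (suc k) (suc k) → Set ℓ
  IsCirculant {k} M = ∀ (i : Fin k) (j : Fin (suc k)) →
    M (suc i) j ≈ M (Fin.inject₁ i) (predMod j)

  IsReverseCirculant : ∀ {k} → Matrix (suc k) (suc k) → Set ℓ
  IsReverseCirculant {k} M = ∀ (i : Fin k) (j : Fin (suc k)) →
    M (suc i) j ≈ M (Fin.inject₁ i) (succMod j)

  ⟨_,_⟩ : ∀ {N} → Vector N → Vector N → Carrier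
  ⟨ x , y ⟩ = Σ[ (λ i → x i * y i) ]

  GeneratedCode : ∀ {m N} → Matrix m N → Vector N → Set (c ⊔ ℓ)
  GeneratedCode {m} G x = Σ (Vector m) λ u → ∀ j → x j ≈ Σ[ (λ i → u i * G i j) ]

  Dual : ∀ {N} → (Vector N → Set (c ⊔ ℓ)) → Vector N → Set (c ⊔ ℓ)
  Dual C x = ∀ y → C y → ⟨ x , y ⟩ ≈ 0#

  IsSelfDual : ∀ {N} → (Vector N → Set (c ⊔ ℓ)) → Set (c ⊔ ℓ)
  IsSelfDual C = ∀ x → (C x → Dual C x) × (Dual C x → C x)

  IsFinite : Set (c ⊔ ℓ)
  IsFinite = Σ ℕ λ n → Σ (Fin n → Carrier) λ f → ∀ x → Σ (Fin n) λ i → f i ≈ x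

  HasCharacteristic2 : Set ℓ
  HasCharacteristic2 = (¬ (1# ≈ 0#)) × (1# + 1# ≈ 0#)

  record Ideal : Set (lsuc (c ⊔ ℓ)) where
    field
      _∈I : Carrier → Set (c ⊔ ℓ)
      resp : ∀ {x y} → x ≈ y → x ∈I → y ∈I
      zero∈ : 0# ∈I
      +-closed : ∀ {x y} → x ∈I → y ∈I → (x + y) ∈I
      *-closed : ∀ r {x} → x ∈I → (r * x) ∈I
  open Ideal public

  _⊆ᴵ_ : Ideal → Ideal → Set (c ⊔ ℓ)
  I ⊆ᴵ J = ∀ x → _∈I I x → _∈I J x

  IsMaximalIdeal : Ideal → Set (lsuc (c ⊔ ℓ))
  IsMaximalIdeal I = (¬ _∈I I 1#) ×
    (∀ (J : Ideal) → I ⊆ᴵ J → (J ⊆ᴵ I) ⊎ _∈I J 1#)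

  IsNonzeroIdeal : Ideal → Set (c ⊔ ℓ)
  IsNonzeroIdeal I = Σ Carrier λ x → _∈I I x × ¬ (x ≈ 0#)

  IsMinimalIdeal : Ideal → Set (lsuc (c ⊔ ℓ))
  IsMinimalIdeal I = IsNonzeroIdeal I ×
    (∀ (J : Ideal) → J ⊆ᴵ I → IsNonzeroIdeal J → I ⊆ᴵ J)

  _∈Rad : Carrier → Set (lsuc (c ⊔ ℓ))
  x ∈Rad = ∀ (I : Ideal) → IsMaximalIdeal I → _∈I I x

  listSum : List Carrier → Carrier
  listSum [] = 0#
  listSum (y ∷ ys) = y + listSum ys

  InSomeMinimalIdeal : Carrier → Set (lsuc (c ⊔ ℓ))
  InSomeMinimalIdeal y = Σ Ideal λ I → IsMinimalIdeal I × _∈I I y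

  _∈Soc : Carrier → Set (lsuc (c ⊔ ℓ))
  x ∈Soc = Σ (List Carrier) λ ys → (x ≈ listSum ys) × All InSomeMinimalIdeal ys

  -- R/Rad(R) ≅ Soc(R) as R-modules: an R-linear map f : R → Soc(R), well defined
  -- on R/Rad(R), injective on R/Rad(R) and onto Soc(R)
  QuotientRadIsoSocle : Set (lsuc (c ⊔ ℓ))
  QuotientRadIsoSocle = Σ (Carrier → Carrier) λ f →
      (∀ x → f x ∈Soc)
    × (∀ x y → (x - y) ∈Rad → f x ≈ f y)
    × (∀ x y → f (x + y) ≈ f x + f y)
    × (∀ r x → f (r * x) ≈ r * f x)
    × (∀ x y → f x ≈ f y → (x - y) ∈Rad)
    × (∀ s → s ∈Soc → Σ Carrier λ x → f x ≈ s)

  -- a (commutative) Frobenius ring: a finite ring with R/Rad(R) ≅ Soc(R) as R-modules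
  -- (left and right coincide since R is commutative)
  IsFrobenius : Set (lsuc (c ⊔ ℓ))
  IsFrobenius = IsFinite × QuotientRadIsoSocle

  DCGenerator : ∀ {k} → let n = suc k in
    Matrix n n → Matrix n n → Matrix n n → Matrix n n
    → Matrix (n ℕ.+ n) ((n ℕ.+ n) ℕ.+ (n ℕ.+ n))
  DCGenerator {k} P Q S T = hcat (identity (suc k ℕ.+ suc k)) (block P Q S T)

-- The matrix (I | M) generates a self-dual code iff M Mᵀ = -I and Mᵀ M = -I, written
-- below as I + M Mᵀ = 0 and I + Mᵀ M = 0.  A reverse circulant C is symmetric, so the
-- new generator is (I | M′) with M′ = (A, B + C; (B + C)ᵀ, Aᵀ).  By block
-- multiplication, replacing B by B + C changes M Mᵀ only by B Cᵀ + C Bᵀ + C Cᵀ,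
-- Bᵀ C + Cᵀ B + Cᵀ C, A C + C A and its transpose.  In characteristic 2 all of these
-- vanish, because C² = 0, A C = C A, and B C, Bᵀ C are symmetric: Bᵀ is circulant as
-- well, and a circulant times a reverse circulant is reverse circulant, hence
-- symmetric.  Since Aᵀ also commutes with C, the same computation with Aᵀ in place of A
-- gives M′ᵀ M′ = Mᵀ M.

module Submission where

open import Defs
open import Level using (_⊔_)
open import Algebra.Bundles using (CommutativeRing)
open import Data.Nat as ℕ using (ℕ; zero; suc; s<s)
open import Data.Nat.DivMod using (_%_; _mod_; %-distribˡ-+; m%n%n≡m%n; [m+kn]%n≡m%n; m<n⇒m%n≡m; n%n≡0)
open import Data.Nat.Properties as ℕₚ using ()
open import Data.Fin as Fin using (Fin; zero; suc; toℕ; fromℕ; inject₁; splitAt; _↑ˡ_; _↑ʳ_; punchIn)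
open import Data.Fin.Properties
  using (toℕ-fromℕ<; toℕ-injective; toℕ<n; toℕ-inject₁; toℕ-fromℕ; punchInᵢ≢i;
         splitAt-↑ˡ; splitAt-↑ʳ; splitAt⁻¹-↑ˡ; splitAt⁻¹-↑ʳ)
open import Data.Fin.Induction using (<-weakInduction)
import Data.Fin.Relation.Unary.Top as Top
open import Data.Fin.Permutation using (Permutation; permutation)
open import Data.Sum using (_⊎_; inj₁; inj₂)
open import Data.Product using (_×_; _,_; proj₁; proj₂)
open import Data.Empty using (⊥-elim)
open import Function using (_∘_)
open import Relation.Binary.Bundles using (Setoid)
open import Relation.Binary.PropositionalEquality as ≡ using (_≡_; _≢_)
open import Relation.Nullary using (yes; no)
import Relation.Binary.Reasoning.Setoid as SetoidReasoning
import Data.Vec.Functional.Relation.Binary.Equality.Setoid as PointwiseEquality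

-- Rotations of Fin (suc k)

module _ {k : ℕ} where
  open import Data.Nat using (_+_; _*_)
  open ≡ using (trans; cong)
  open ≡.≡-Reasoning

  rotate : ℕ → Fin (suc k) → Fin (suc k)
  rotate t j = (t + toℕ j) mod suc k

  toℕ-rotate : ∀ t j → toℕ (rotate t j) ≡ (t + toℕ j) % suc k
  toℕ-rotate t j = toℕ-fromℕ< _

  [m+n%d]%d≡[m+n]%d : ∀ m n d .{{_ : ℕ.NonZero d}} → (m + n % d) % d ≡ (m + n) % d
  [m+n%d]%d≡[m+n]%d m n d = begin
    (m + n % d) % d           ≡⟨ %-distribˡ-+ m (n % d) d ⟩
    (m % d + n % d % d) % d   ≡⟨ cong (λ x → (m % d + x) % d) (m%n%n≡m%n n d) ⟩
    (m % d + n % d) % d       ≡⟨ %-distribˡ-+ m n d ⟨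
    (m + n) % d               ∎

  rotate-rotate : ∀ s t j → rotate s (rotate t j) ≡ rotate (s + t) j
  rotate-rotate s t j = toℕ-injective (begin
    toℕ (rotate s (rotate t j))           ≡⟨ toℕ-rotate s (rotate t j) ⟩
    (s + toℕ (rotate t j)) % suc k        ≡⟨ cong (λ x → (s + x) % suc k) (toℕ-rotate t j) ⟩
    (s + (t + toℕ j) % suc k) % suc k     ≡⟨ [m+n%d]%d≡[m+n]%d s (t + toℕ j) (suc k) ⟩
    (s + (t + toℕ j)) % suc k             ≡⟨ cong (_% suc k) (ℕₚ.+-assoc s t (toℕ j)) ⟨
    (s + t + toℕ j) % suc k               ≡⟨ toℕ-rotate (s + t) j ⟨
    toℕ (rotate (s + t) j)                ∎)

  rotate-multiple : ∀ m j → rotate (m * suc k) j ≡ j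
  rotate-multiple m j = toℕ-injective (begin
    toℕ (rotate (m * suc k) j)        ≡⟨ toℕ-rotate (m * suc k) j ⟩
    (m * suc k + toℕ j) % suc k       ≡⟨ cong (_% suc k) (ℕₚ.+-comm (m * suc k) (toℕ j)) ⟩
    (toℕ j + m * suc k) % suc k       ≡⟨ [m+kn]%n≡m%n (toℕ j) m (suc k) ⟩
    toℕ j % suc k                     ≡⟨ m<n⇒m%n≡m (toℕ<n j) ⟩
    toℕ j                             ∎)

  rotate-zero : ∀ j → rotate 0 j ≡ j
  rotate-zero = rotate-multiple 0

  rotate-cancel : ∀ s t m j → s + t ≡ m * suc k → rotate s (rotate t j) ≡ j
  rotate-cancel s t m j s+t≡ = trans (rotate-rotate s t j) (trans (cong (λ u → rotate u j) s+t≡) (rotate-multiple m j))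

  rotate-inject₁ : ∀ (i : Fin k) → rotate 1 (inject₁ i) ≡ suc i
  rotate-inject₁ i = toℕ-injective (begin
    toℕ (rotate 1 (inject₁ i))      ≡⟨ toℕ-rotate 1 (inject₁ i) ⟩
    suc (toℕ (inject₁ i)) % suc k   ≡⟨ cong (λ x → suc x % suc k) (toℕ-inject₁ i) ⟩
    suc (toℕ i) % suc k             ≡⟨ m<n⇒m%n≡m (s<s (toℕ<n i)) ⟩
    suc (toℕ i)                     ∎)

  rotate-fromℕ : rotate 1 (fromℕ k) ≡ zero
  rotate-fromℕ = toℕ-injective (begin
    toℕ (rotate 1 (fromℕ k))   ≡⟨ toℕ-rotate 1 (fromℕ k) ⟩
    suc (toℕ (fromℕ k)) % suc k ≡⟨ cong (λ x → suc x % suc k) (toℕ-fromℕ k) ⟩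
    suc k % suc k               ≡⟨ n%n≡0 (suc k) ⟩
    0                           ∎)

  predMod≡rotate : ∀ j → predMod j ≡ rotate k j
  predMod≡rotate j = cong (_mod suc k) (ℕₚ.+-comm (toℕ j) k)

  rotate-k∘rotate-1 : ∀ j → rotate k (rotate 1 j) ≡ j
  rotate-k∘rotate-1 j = rotate-cancel k 1 1 j (trans (ℕₚ.+-comm k 1) (≡.sym (ℕₚ.*-identityˡ (suc k))))

  rotate-1∘rotate-k : ∀ j → rotate 1 (rotate k j) ≡ j
  rotate-1∘rotate-k j = rotate-cancel 1 k 1 j (≡.sym (ℕₚ.*-identityˡ (suc k)))

  rotation : Permutation (suc k) (suc k)
  rotation = permutation (rotate 1) (rotate k) rotate-1∘rotate-k rotate-k∘rotate-1

module Matrices {c ℓ} (R : CommutativeRing c ℓ) where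
  open CommutativeRing R hiding (zero)
  open import Algebra.Properties.Ring ring using (+-inverseˡ-unique; -‿distribˡ-*; -1*x≈-x)
  open import Algebra.Properties.CommutativeSemigroup +-commutativeSemigroup using (interchange)
  open import Algebra.Properties.Semiring.Sum semiring
    using (sum; sum-cong-≋; sum-replicate-zero; sum-remove; *-distribˡ-sum; *-distribʳ-sum; sum-permute)
    renaming (∑-distrib-+ to sum-distrib-+; ∑-comm to sum-comm)

  private variable
    a b d e m n p : ℕ

  ∑ : (Fin n → Carrier) → Carrier
  ∑ = Σ[_] R

  ∑≈sum : (f : Fin n → Carrier) → ∑ f ≈ sum f
  ∑≈sum {zero} f = refl
  ∑≈sum {suc n} f = +-congˡ (∑≈sum (f ∘ suc))

  ∑-cong : {f g : Fin n → Carrier} → (∀ i → f i ≈ g i) → ∑ f ≈ ∑ g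
  ∑-cong {f = f} {g} f≈g = trans (∑≈sum f) (trans (sum-cong-≋ f≈g) (sym (∑≈sum g)))

  ∑-≡ : {f g : Fin n → Carrier} → (∀ i → f i ≡ g i) → ∑ f ≈ ∑ g
  ∑-≡ f≡g = ∑-cong (reflexive ∘ f≡g)

  ∑-zero : {f : Fin n → Carrier} → (∀ i → f i ≈ 0#) → ∑ f ≈ 0#
  ∑-zero {n} f≈0 = trans (∑-cong f≈0) (trans (∑≈sum {n} (λ _ → 0#)) (sum-replicate-zero n))

  ∑-+ : (f g : Fin n → Carrier) → ∑ (λ i → f i + g i) ≈ ∑ f + ∑ g
  ∑-+ f g = trans (∑≈sum (λ i → f i + g i)) (trans (sum-distrib-+ f g) (sym (+-cong (∑≈sum f) (∑≈sum g))))

  ∑-*ˡ : ∀ x (f : Fin n → Carrier) → x * ∑ f ≈ ∑ (λ i → x * f i)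
  ∑-*ˡ x f = trans (*-congˡ (∑≈sum f)) (trans (*-distribˡ-sum x f) (sym (∑≈sum (λ i → x * f i))))

  ∑-*ʳ : ∀ x (f : Fin n → Carrier) → ∑ f * x ≈ ∑ (λ i → f i * x)
  ∑-*ʳ x f = trans (*-congʳ (∑≈sum f)) (trans (*-distribʳ-sum x f) (sym (∑≈sum (λ i → f i * x))))

  ∑-neg : (f : Fin n → Carrier) → - ∑ f ≈ ∑ (λ i → - f i)
  ∑-neg f = trans (sym (-1*x≈-x _)) (trans (∑-*ˡ (- 1#) f) (∑-cong (λ i → -1*x≈-x (f i))))

  ∑-comm : (f : Fin m → Fin n → Carrier) → ∑ (λ i → ∑ (f i)) ≈ ∑ (λ j → ∑ (λ i → f i j))
  ∑-comm f = begin
    ∑ (λ i → ∑ (f i))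
      ≈⟨ trans (∑≈sum (λ i → ∑ (f i))) (sum-cong-≋ (λ i → ∑≈sum (f i))) ⟩
    sum (λ i → sum (f i))
      ≈⟨ sum-comm f ⟩
    sum (λ j → sum (λ i → f i j))
      ≈⟨ trans (sum-cong-≋ (λ j → sym (∑≈sum (λ i → f i j)))) (sym (∑≈sum (λ j → ∑ (λ i → f i j)))) ⟩
    ∑ (λ j → ∑ (λ i → f i j)) ∎
    where open SetoidReasoning setoid

  ∑-split : (f : Fin (a ℕ.+ b) → Carrier) → ∑ f ≈ ∑ (f ∘ (_↑ˡ b)) + ∑ (f ∘ (a ↑ʳ_))
  ∑-split {zero} f = sym (+-identityˡ _)
  ∑-split {suc a} {b} f = trans (+-congˡ (∑-split {a} {b} (f ∘ suc))) (sym (+-assoc _ _ _))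

  ∑-single : ∀ (i : Fin n) (f : Fin n → Carrier) → (∀ j → j ≢ i → f j ≈ 0#) → ∑ f ≈ f i
  ∑-single {suc n} i f h = begin
    ∑ f
      ≈⟨ ∑≈sum f ⟩
    sum f
      ≈⟨ sum-remove {i = i} f ⟩
    f i + sum (f ∘ punchIn i)
      ≈⟨ +-congˡ (trans (sym (∑≈sum (f ∘ punchIn i))) (∑-zero (λ j → h _ (punchInᵢ≢i i j)))) ⟩
    f i + 0#
      ≈⟨ +-identityʳ _ ⟩
    f i ∎
    where open SetoidReasoning setoid

  ∑-rotate : ∀ {k} (f : Fin (suc k) → Carrier) → ∑ f ≈ ∑ (f ∘ rotate 1)
  ∑-rotate f = trans (∑≈sum f) (trans (sum-permute f rotation) (sym (∑≈sum (f ∘ rotate 1))))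

  infix  4 _≋_
  infixl 6 _⊕_
  infixl 7 _·_
  infix  9 _ᵀ

  _≋_ : Matrix R m n → Matrix R m n → Set ℓ
  _≋_ = _≈ᴹ_ R

  _⊕_ : Matrix R m n → Matrix R m n → Matrix R m n
  _⊕_ = _+ᴹ_ R

  _·_ : Matrix R m n → Matrix R n p → Matrix R m p
  _·_ = _*ᴹ_ R

  _ᵀ : Matrix R m n → Matrix R n m
  _ᵀ = transpose R

  𝟎 : Matrix R m n
  𝟎 = zeroᴹ R

  𝐈 : ∀ n → Matrix R n n
  𝐈 = identity R

  -ᴹ_ : Matrix R m n → Matrix R m n
  (-ᴹ X) i j = - X i j

  gram : Matrix R m n → Matrix R m m
  gram X = X · X ᵀ

  IsSymmetric : Matrix R n n → Set ℓ
  IsSymmetric X = X ᵀ ≋ X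

  ≋-setoid : ℕ → ℕ → Setoid c ℓ
  ≋-setoid m n = PointwiseEquality.≋-setoid (PointwiseEquality.≋-setoid setoid n) m

  module ≋ {m n} = Setoid (≋-setoid m n)
  module ≋-Reasoning {m n} = SetoidReasoning (≋-setoid m n)

  ·-cong : {X X′ : Matrix R m n} {Y Y′ : Matrix R n p} → X ≋ X′ → Y ≋ Y′ → X · Y ≋ X′ · Y′
  ·-cong {n = n} X≋X′ Y≋Y′ i j = ∑-cong {n} (λ l → *-cong (X≋X′ i l) (Y≋Y′ l j))

  ·-congˡ : (X : Matrix R m n) {Y Y′ : Matrix R n p} → Y ≋ Y′ → X · Y ≋ X · Y′
  ·-congˡ X = ·-cong ≋.refl

  ·-congʳ : {X X′ : Matrix R m n} (Y : Matrix R n p) → X ≋ X′ → X · Y ≋ X′ · Y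
  ·-congʳ Y X≋X′ = ·-cong X≋X′ ≋.refl

  ⊕-cong : {X X′ Y Y′ : Matrix R m n} → X ≋ X′ → Y ≋ Y′ → X ⊕ Y ≋ X′ ⊕ Y′
  ⊕-cong X≋X′ Y≋Y′ i j = +-cong (X≋X′ i j) (Y≋Y′ i j)

  ⊕-congˡ : (X : Matrix R m n) {Y Y′ : Matrix R m n} → Y ≋ Y′ → X ⊕ Y ≋ X ⊕ Y′
  ⊕-congˡ X = ⊕-cong ≋.refl

  ᵀ-cong : {X Y : Matrix R m n} → X ≋ Y → X ᵀ ≋ Y ᵀ
  ᵀ-cong X≋Y i j = X≋Y j i

  gram-cong : {X Y : Matrix R m n} → X ≋ Y → gram X ≋ gram Y
  gram-cong X≋Y = ·-cong X≋Y (ᵀ-cong X≋Y)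

  ·-assoc : (X : Matrix R m n) (Y : Matrix R n p) (Z : Matrix R p d) → (X · Y) · Z ≋ X · (Y · Z)
  ·-assoc {n = n} {p = p} X Y Z i j = begin
    ∑ (λ l → ∑ (λ k → X i k * Y k l) * Z l j)    ≈⟨ ∑-cong {p} (λ l → ∑-*ʳ (Z l j) (λ k → X i k * Y k l)) ⟩
    ∑ (λ l → ∑ (λ k → X i k * Y k l * Z l j))    ≈⟨ ∑-comm (λ l k → X i k * Y k l * Z l j) ⟩
    ∑ (λ k → ∑ (λ l → X i k * Y k l * Z l j))    ≈⟨ ∑-cong {n} (λ k → ∑-cong {p} (λ l → *-assoc _ _ _)) ⟩
    ∑ (λ k → ∑ (λ l → X i k * (Y k l * Z l j)))  ≈⟨ ∑-cong {n} (λ k → ∑-*ˡ (X i k) (λ l → Y k l * Z l j)) ⟨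
    ∑ (λ k → X i k * ∑ (λ l → Y k l * Z l j))    ∎
    where open SetoidReasoning setoid

  ·-distribˡ : (X : Matrix R m n) (Y Z : Matrix R n p) → X · (Y ⊕ Z) ≋ X · Y ⊕ X · Z
  ·-distribˡ {n = n} X Y Z i j =
    trans (∑-cong {n} (λ l → distribˡ (X i l) _ _)) (∑-+ (λ l → X i l * Y l j) (λ l → X i l * Z l j))

  ·-distribʳ : (X Y : Matrix R m n) (Z : Matrix R n p) → (X ⊕ Y) · Z ≋ X · Z ⊕ Y · Z
  ·-distribʳ {n = n} X Y Z i j =
    trans (∑-cong {n} (λ l → distribʳ (Z l j) _ _)) (∑-+ (λ l → X i l * Z l j) (λ l → Y i l * Z l j))

  ·-zeroˡ : (X : Matrix R n p) → 𝟎 {m} · X ≋ 𝟎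
  ·-zeroˡ {n} X i j = ∑-zero {n} (λ l → zeroˡ (X l j))

  ·-zeroʳ : (X : Matrix R m n) → X · 𝟎 {n} {p} ≋ 𝟎
  ·-zeroʳ {n = n} X i j = ∑-zero {n} (λ l → zeroʳ (X i l))

  transpose-· : (X : Matrix R m n) (Y : Matrix R n p) → (X · Y) ᵀ ≋ Y ᵀ · X ᵀ
  transpose-· {n = n} X Y i j = ∑-cong {n} (λ l → *-comm (X j l) (Y l i))

  -ᴹ-· : (X : Matrix R m n) (Y : Matrix R n p) → (-ᴹ X) · Y ≋ -ᴹ (X · Y)
  -ᴹ-· {n = n} X Y i j =
    trans (∑-cong {n} (λ l → sym (-‿distribˡ-* (X i l) (Y l j)))) (sym (∑-neg (λ l → X i l * Y l j)))

  private
    𝐈-cases : ∀ (i j : Fin n) → (i ≡ j × 𝐈 n i j ≈ 1#) ⊎ (i ≢ j × 𝐈 n i j ≈ 0#)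
    𝐈-cases i j with i Fin.≟ j
    ... | yes i≡j = inj₁ (i≡j , refl)
    ... | no i≢j = inj₂ (i≢j , refl)

  𝐈-diag : ∀ (i : Fin n) → 𝐈 n i i ≈ 1#
  𝐈-diag i with 𝐈-cases i i
  ... | inj₁ (_ , 𝐈ᵢᵢ≈1) = 𝐈ᵢᵢ≈1
  ... | inj₂ (i≢i , _) = ⊥-elim (i≢i ≡.refl)

  𝐈-off : ∀ {i j : Fin n} → i ≢ j → 𝐈 n i j ≈ 0#
  𝐈-off {i = i} {j} i≢j with 𝐈-cases i j
  ... | inj₁ (i≡j , _) = ⊥-elim (i≢j i≡j)
  ... | inj₂ (_ , 𝐈ᵢⱼ≈0) = 𝐈ᵢⱼ≈0

  𝐈-symmetric : IsSymmetric (𝐈 n)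
  𝐈-symmetric i j with 𝐈-cases i j
  ... | inj₁ (≡.refl , _) = refl
  ... | inj₂ (i≢j , 𝐈ᵢⱼ≈0) = trans (𝐈-off (i≢j ∘ ≡.sym)) (sym 𝐈ᵢⱼ≈0)

  ·-identityˡ : (X : Matrix R m n) → 𝐈 m · X ≋ X
  ·-identityˡ X i j = begin
    ∑ (λ l → 𝐈 _ i l * X l j)
      ≈⟨ ∑-single i (λ l → 𝐈 _ i l * X l j) (λ l l≢i → trans (*-congʳ (𝐈-off (l≢i ∘ ≡.sym))) (zeroˡ _)) ⟩
    𝐈 _ i i * X i j
      ≈⟨ trans (*-congʳ (𝐈-diag i)) (*-identityˡ _) ⟩
    X i j ∎
    where open SetoidReasoning setoid

  ·-identityʳ : (X : Matrix R m n) → X · 𝐈 n ≋ X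
  ·-identityʳ X i j = ≋.trans (≋.trans (transpose-· X (𝐈 _)) (·-congʳ (X ᵀ) 𝐈-symmetric)) (·-identityˡ (X ᵀ)) j i

  ⊕-inverseˡ-unique : {X Y Z : Matrix R m n} → X ⊕ Z ≋ 𝟎 → Y ⊕ Z ≋ 𝟎 → X ≋ Y
  ⊕-inverseˡ-unique X⊕Z≋𝟎 Y⊕Z≋𝟎 i j =
    trans (+-inverseˡ-unique _ _ (X⊕Z≋𝟎 i j)) (sym (+-inverseˡ-unique _ _ (Y⊕Z≋𝟎 i j)))

  Y⊕Y·K≋𝟎 : (Y : Matrix R p m) {K : Matrix R m m} → 𝐈 m ⊕ K ≋ 𝟎 → Y ⊕ Y · K ≋ 𝟎
  Y⊕Y·K≋𝟎 {m = m} Y {K} 𝐈⊕K≋𝟎 = begin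
    Y ⊕ Y · K              ≈⟨ ⊕-cong (≋.sym (·-identityʳ Y)) ≋.refl ⟩
    Y · 𝐈 m ⊕ Y · K        ≈⟨ ·-distribˡ Y (𝐈 m) K ⟨
    Y · (𝐈 m ⊕ K)          ≈⟨ ·-congˡ Y 𝐈⊕K≋𝟎 ⟩
    Y · 𝟎                  ≈⟨ ·-zeroʳ Y ⟩
    𝟎                      ∎
    where open ≋-Reasoning

  symmetric-resp : {X Y : Matrix R n n} → X ≋ Y → IsSymmetric X → IsSymmetric Y
  symmetric-resp X≋Y X-sym i j = trans (sym (X≋Y j i)) (trans (X-sym i j) (X≋Y i j))

  commute-transpose : {X C : Matrix R n n} → IsSymmetric C → X · C ≋ C · X → X ᵀ · C ≋ C · X ᵀ
  commute-transpose {X = X} {C} C-sym XC≋CX = begin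
    X ᵀ · C        ≈⟨ ·-congˡ (X ᵀ) C-sym ⟨
    X ᵀ · C ᵀ      ≈⟨ transpose-· C X ⟨
    (C · X) ᵀ      ≈⟨ ᵀ-cong XC≋CX ⟨
    (X · C) ᵀ      ≈⟨ transpose-· X C ⟩
    C ᵀ · X ᵀ      ≈⟨ ·-congʳ (X ᵀ) C-sym ⟩
    C · X ᵀ        ∎
    where open ≋-Reasoning

  left : Matrix R p (a ℕ.+ b) → Matrix R p a
  left {b = b} X i j = X i (j ↑ˡ b)

  right : Matrix R p (a ℕ.+ b) → Matrix R p b
  right {a = a} X i j = X i (a ↑ʳ j)

  top : Matrix R (a ℕ.+ b) p → Matrix R a p
  top {b = b} X i j = X (i ↑ˡ b) j

  bottom : Matrix R (a ℕ.+ b) p → Matrix R b p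
  bottom {a = a} X i j = X (a ↑ʳ i) j

  ≋-by-columns : {X Y : Matrix R p (a ℕ.+ b)} → left {a = a} X ≋ left Y → right {a = a} X ≋ right Y → X ≋ Y
  ≋-by-columns {a = a} {X = X} {Y} l r i j with splitAt a j in eq
  ... | inj₁ j′ = ≡.subst (λ j → X i j ≈ Y i j) (splitAt⁻¹-↑ˡ eq) (l i j′)
  ... | inj₂ j′ = ≡.subst (λ j → X i j ≈ Y i j) (splitAt⁻¹-↑ʳ eq) (r i j′)

  ≋-by-rows : {X Y : Matrix R (a ℕ.+ b) p} → top {a = a} X ≋ top Y → bottom {a = a} X ≋ bottom Y → X ≋ Y
  ≋-by-rows {a = a} {X = X} {Y} t u i j =
    ≋-by-columns {a = a} {X = X ᵀ} {Y ᵀ} (λ j′ i′ → t i′ j′) (λ j′ i′ → u i′ j′) j i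

  ·-split : (X : Matrix R m (a ℕ.+ b)) (Y : Matrix R (a ℕ.+ b) n) →
    X · Y ≋ left {a = a} X · top {a = a} Y ⊕ right {a = a} X · bottom {a = a} Y
  ·-split {a = a} {b} X Y i j = ∑-split {a} {b} (λ l → X i l * Y l j)

  hcat-↑ˡ : (P : Matrix R m a) (Q : Matrix R m b) → left (hcat R P Q) ≋ P
  hcat-↑ˡ {a = a} {b} P Q i j rewrite splitAt-↑ˡ a j b = refl

  hcat-↑ʳ : (P : Matrix R m a) (Q : Matrix R m b) → right (hcat R P Q) ≋ Q
  hcat-↑ʳ {a = a} {b} P Q i j rewrite splitAt-↑ʳ a b j = refl

  module _ (P : Matrix R a d) (Q : Matrix R a e) (S : Matrix R b d) (T : Matrix R b e) where
    block-↑ˡ↑ˡ : left {a = d} (top {a = a} (block R P Q S T)) ≋ P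
    block-↑ˡ↑ˡ i j rewrite splitAt-↑ˡ a i b | splitAt-↑ˡ d j e = refl

    block-↑ˡ↑ʳ : right {a = d} (top {a = a} (block R P Q S T)) ≋ Q
    block-↑ˡ↑ʳ i j rewrite splitAt-↑ˡ a i b | splitAt-↑ʳ d e j = refl

    block-↑ʳ↑ˡ : left {a = d} (bottom {a = a} (block R P Q S T)) ≋ S
    block-↑ʳ↑ˡ i j rewrite splitAt-↑ʳ a b i | splitAt-↑ˡ d j e = refl

    block-↑ʳ↑ʳ : right {a = d} (bottom {a = a} (block R P Q S T)) ≋ T
    block-↑ʳ↑ʳ i j rewrite splitAt-↑ʳ a b i | splitAt-↑ʳ d e j = refl

    ≋-block : {X : Matrix R (a ℕ.+ b) (d ℕ.+ e)} →
      left {a = d} (top {a = a} X) ≋ P → right {a = d} (top {a = a} X) ≋ Q →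
      left {a = d} (bottom {a = a} X) ≋ S → right {a = d} (bottom {a = a} X) ≋ T →
      X ≋ block R P Q S T
    ≋-block XP XQ XS XT = ≋-by-rows {a = a}
      (≋-by-columns {a = d} (≋.trans XP (≋.sym block-↑ˡ↑ˡ)) (≋.trans XQ (≋.sym block-↑ˡ↑ʳ)))
      (≋-by-columns {a = d} (≋.trans XS (≋.sym block-↑ʳ↑ˡ)) (≋.trans XT (≋.sym block-↑ʳ↑ʳ)))

  block-cong : {P P′ : Matrix R a d} {Q Q′ : Matrix R a e} {S S′ : Matrix R b d} {T T′ : Matrix R b e} →
    P ≋ P′ → Q ≋ Q′ → S ≋ S′ → T ≋ T′ → block R P Q S T ≋ block R P′ Q′ S′ T′
  block-cong {P = P} {P′} {Q} {Q′} {S} {S′} {T} {T′} P≋ Q≋ S≋ T≋ = ≋-block P′ Q′ S′ T′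
    (≋.trans (block-↑ˡ↑ˡ P Q S T) P≋) (≋.trans (block-↑ˡ↑ʳ P Q S T) Q≋)
    (≋.trans (block-↑ʳ↑ˡ P Q S T) S≋) (≋.trans (block-↑ʳ↑ʳ P Q S T) T≋)

  transpose-block : (P : Matrix R a d) (Q : Matrix R a e) (S : Matrix R b d) (T : Matrix R b e) →
    block R P Q S T ᵀ ≋ block R (P ᵀ) (S ᵀ) (Q ᵀ) (T ᵀ)
  transpose-block P Q S T = ≋-block (P ᵀ) (S ᵀ) (Q ᵀ) (T ᵀ)
    (λ i j → block-↑ˡ↑ˡ P Q S T j i) (λ i j → block-↑ʳ↑ˡ P Q S T j i)
    (λ i j → block-↑ˡ↑ʳ P Q S T j i) (λ i j → block-↑ʳ↑ʳ P Q S T j i)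

  block-· : ∀ {f g} (P : Matrix R a d) (Q : Matrix R a e) (S : Matrix R b d) (T : Matrix R b e)
    (P′ : Matrix R d f) (Q′ : Matrix R d g) (S′ : Matrix R e f) (T′ : Matrix R e g) →
    block R P Q S T · block R P′ Q′ S′ T′
      ≋ block R (P · P′ ⊕ Q · S′) (P · Q′ ⊕ Q · T′) (S · P′ ⊕ T · S′) (S · Q′ ⊕ T · T′)
  block-· {a} {d} {e} {b} {f} {g} P Q S T P′ Q′ S′ T′ = ≋-block _ _ _ _
    (λ i j → trans (split (i ↑ˡ b) (j ↑ˡ g)) (+-cong (·-cong X₁₁ Y₁₁ i j) (·-cong X₁₂ Y₂₁ i j)))
    (λ i j → trans (split (i ↑ˡ b) (f ↑ʳ j)) (+-cong (·-cong X₁₁ Y₁₂ i j) (·-cong X₁₂ Y₂₂ i j)))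
    (λ i j → trans (split (a ↑ʳ i) (j ↑ˡ g)) (+-cong (·-cong X₂₁ Y₁₁ i j) (·-cong X₂₂ Y₂₁ i j)))
    (λ i j → trans (split (a ↑ʳ i) (f ↑ʳ j)) (+-cong (·-cong X₂₁ Y₁₂ i j) (·-cong X₂₂ Y₂₂ i j)))
    where
    split = ·-split {a = d} (block R P Q S T) (block R P′ Q′ S′ T′)
    X₁₁ = block-↑ˡ↑ˡ P Q S T
    X₁₂ = block-↑ˡ↑ʳ P Q S T
    X₂₁ = block-↑ʳ↑ˡ P Q S T
    X₂₂ = block-↑ʳ↑ʳ P Q S T
    Y₁₁ = block-↑ˡ↑ˡ P′ Q′ S′ T′
    Y₁₂ = block-↑ˡ↑ʳ P′ Q′ S′ T′
    Y₂₁ = block-↑ʳ↑ˡ P′ Q′ S′ T′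
    Y₂₂ = block-↑ʳ↑ʳ P′ Q′ S′ T′

  fourBlock : Matrix R n n → Matrix R n n → Matrix R (n ℕ.+ n) (n ℕ.+ n)
  fourBlock X Y = block R X Y (Y ᵀ) (X ᵀ)

  transpose-fourBlock : (X Y : Matrix R n n) → fourBlock X Y ᵀ ≋ fourBlock (X ᵀ) Y
  transpose-fourBlock X Y = transpose-block X Y (Y ᵀ) (X ᵀ)

  fourBlock-⊕ : (X Y C : Matrix R n n) → IsSymmetric C → block R X (Y ⊕ C) (Y ᵀ ⊕ C) (X ᵀ) ≋ fourBlock X (Y ⊕ C)
  fourBlock-⊕ X Y C C-sym =
    block-cong {P = X} {Q = Y ⊕ C} {S = Y ᵀ ⊕ C} {T = X ᵀ} ≋.refl ≋.refl (⊕-congˡ (Y ᵀ) (≋.sym C-sym)) ≋.refl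

  gram-fourBlock : (X Y : Matrix R n n) → gram (fourBlock X Y)
    ≋ block R (gram X ⊕ gram Y) (X · Y ⊕ Y · X) (Y ᵀ · X ᵀ ⊕ X ᵀ · Y ᵀ) (gram (Y ᵀ) ⊕ gram (X ᵀ))
  gram-fourBlock X Y =
    ≋.trans (·-congˡ (fourBlock X Y) (transpose-fourBlock X Y)) (block-· X Y (Y ᵀ) (X ᵀ) (X ᵀ) Y (Y ᵀ) X)

  -- Codes with a systematic generator matrix (I | M)

  rowᴹ : Vector R n → Matrix R 1 n
  rowᴹ x _ = x

  RowsIn : (Vector R n → Set (c ⊔ ℓ)) → Matrix R p n → Set (c ⊔ ℓ)
  RowsIn P X = ∀ i → P (X i)

  rows∈code : (G : Matrix R m n) → RowsIn (GeneratedCode R G) G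
  rows∈code {m} G i = 𝐈 m i , λ j → sym (·-identityˡ G i j)

  rowsIn-dual⇒ : (G : Matrix R m n) (X : Matrix R p n) → RowsIn (Dual R (GeneratedCode R G)) X → X · G ᵀ ≋ 𝟎
  rowsIn-dual⇒ G X X⊥ i j = X⊥ i (G j) (rows∈code G j)

  rowsIn-dual⇐ : (G : Matrix R m n) (X : Matrix R p n) → X · G ᵀ ≋ 𝟎 → RowsIn (Dual R (GeneratedCode R G)) X
  rowsIn-dual⇐ {n = n} G X XGᵀ≋𝟎 i y (u , y≈uG) = begin
    ⟨_,_⟩ R (X i) y                  ≈⟨ ∑-cong {n} (λ l → *-congˡ (y≈uG l)) ⟩
    (X · (rowᴹ u · G) ᵀ) i zero      ≈⟨ ·-congˡ X (transpose-· (rowᴹ u) G) i zero ⟩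
    (X · (G ᵀ · rowᴹ u ᵀ)) i zero    ≈⟨ ·-assoc X (G ᵀ) (rowᴹ u ᵀ) i zero ⟨
    ((X · G ᵀ) · rowᴹ u ᵀ) i zero    ≈⟨ ·-congʳ (rowᴹ u ᵀ) XGᵀ≋𝟎 i zero ⟩
    (𝟎 · rowᴹ u ᵀ) i zero            ≈⟨ ·-zeroˡ (rowᴹ u ᵀ) i zero ⟩
    0#                               ∎
    where open SetoidReasoning setoid

  SystematicCode : Matrix R m n → Vector R (m ℕ.+ n) → Set (c ⊔ ℓ)
  SystematicCode {m} M = GeneratedCode R (hcat R (𝐈 m) M)

  module _ (M : Matrix R m n) where
    private
      G = hcat R (𝐈 m) M

    systematic-rowsIn⇒ : (X : Matrix R p (m ℕ.+ n)) → RowsIn (SystematicCode M) X → right {a = m} X ≋ left X · M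
    systematic-rowsIn⇒ X X∈ = ≋.trans right-X (·-congʳ M (≋.sym left-X))
      where
      U = λ i → proj₁ (X∈ i)
      left-X : left {a = m} X ≋ U
      left-X i j = trans (proj₂ (X∈ i) (j ↑ˡ n)) (trans (·-congˡ U (hcat-↑ˡ (𝐈 m) M) i j) (·-identityʳ U i j))
      right-X : right {a = m} X ≋ U · M
      right-X i j = trans (proj₂ (X∈ i) (m ↑ʳ j)) (·-congˡ U (hcat-↑ʳ (𝐈 m) M) i j)

    systematic-rowsIn⇐ : (X : Matrix R p (m ℕ.+ n)) → right {a = m} X ≋ left X · M → RowsIn (SystematicCode M) X
    systematic-rowsIn⇐ X X₂≋X₁M i = left {a = m} X i , X≋X₁G i
      where
      X≋X₁G : X ≋ left {a = m} X · G
      X≋X₁G = ≋-by-columns {a = m}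
        (≋.sym (≋.trans (·-congˡ (left X) (hcat-↑ˡ (𝐈 m) M)) (·-identityʳ (left X))))
        (≋.trans X₂≋X₁M (≋.sym (·-congˡ (left X) (hcat-↑ʳ (𝐈 m) M))))

    ·-systematicᵀ : (X : Matrix R p (m ℕ.+ n)) → X · G ᵀ ≋ left {a = m} X ⊕ right X · M ᵀ
    ·-systematicᵀ X = ≋.trans (·-split {a = m} X (G ᵀ)) (⊕-cong
      (≋.trans (·-congˡ (left X) (≋.trans (ᵀ-cong (hcat-↑ˡ (𝐈 m) M)) 𝐈-symmetric)) (·-identityʳ (left X)))
      (·-congˡ (right X) (ᵀ-cong (hcat-↑ʳ (𝐈 m) M))))

    selfDual⇒ : IsSelfDual R (SystematicCode M) → 𝐈 m ⊕ gram M ≋ 𝟎 × 𝐈 n ⊕ gram (M ᵀ) ≋ 𝟎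
    selfDual⇒ sd = gram-condition , cogram-condition
      where
      gram-condition : 𝐈 m ⊕ gram M ≋ 𝟎
      gram-condition = begin
        𝐈 m ⊕ M · M ᵀ
          ≈⟨ ⊕-cong (≋.sym (hcat-↑ˡ (𝐈 m) M)) (·-congʳ (M ᵀ) (≋.sym (hcat-↑ʳ (𝐈 m) M))) ⟩
        left {a = m} G ⊕ right G · M ᵀ
          ≈⟨ ·-systematicᵀ G ⟨
        G · G ᵀ
          ≈⟨ rowsIn-dual⇒ G G (λ i → proj₁ (sd (G i)) (rows∈code G i)) ⟩
        𝟎 ∎
        where open ≋-Reasoning
      -- The rows of (-Mᵀ | I) are orthogonal to the code, so self-duality puts them in it.
      X : Matrix R n (m ℕ.+ n)
      X = hcat R (-ᴹ M ᵀ) (𝐈 n)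
      XGᵀ≋𝟎 : X · G ᵀ ≋ 𝟎
      XGᵀ≋𝟎 = begin
        X · G ᵀ
          ≈⟨ ·-systematicᵀ X ⟩
        left {a = m} X ⊕ right X · M ᵀ
          ≈⟨ ⊕-cong (hcat-↑ˡ (-ᴹ M ᵀ) (𝐈 n))
                    (≋.trans (·-congʳ (M ᵀ) (hcat-↑ʳ (-ᴹ M ᵀ) (𝐈 n))) (·-identityˡ (M ᵀ))) ⟩
        -ᴹ M ᵀ ⊕ M ᵀ
          ≈⟨ (λ i j → -‿inverseˡ (M j i)) ⟩
        𝟎 ∎
        where open ≋-Reasoning
      X∈code : RowsIn (SystematicCode M) X
      X∈code i = proj₂ (sd (X i)) (rowsIn-dual⇐ G X XGᵀ≋𝟎 i)
      cogram-condition : 𝐈 n ⊕ gram (M ᵀ) ≋ 𝟎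
      cogram-condition = begin
        𝐈 n ⊕ M ᵀ · M
          ≈⟨ ⊕-cong (≋.sym (hcat-↑ʳ (-ᴹ M ᵀ) (𝐈 n))) ≋.refl ⟩
        right {a = m} X ⊕ M ᵀ · M
          ≈⟨ ⊕-cong (systematic-rowsIn⇒ X X∈code) ≋.refl ⟩
        left X · M ⊕ M ᵀ · M
          ≈⟨ ⊕-cong (≋.trans (·-congʳ M (hcat-↑ˡ (-ᴹ M ᵀ) (𝐈 n))) (-ᴹ-· (M ᵀ) M)) ≋.refl ⟩
        -ᴹ (M ᵀ · M) ⊕ M ᵀ · M
          ≈⟨ (λ i j → -‿inverseˡ _) ⟩
        𝟎 ∎
        where open ≋-Reasoning

    selfDual⇐ : 𝐈 m ⊕ gram M ≋ 𝟎 → 𝐈 n ⊕ gram (M ᵀ) ≋ 𝟎 → IsSelfDual R (SystematicCode M)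
    selfDual⇐ gram-condition cogram-condition x = code⇒dual , dual⇒code
      where
      x₁ = left {a = m} (rowᴹ x)
      x₂ = right {a = m} (rowᴹ x)
      code⇒dual : SystematicCode M x → Dual R (SystematicCode M) x
      code⇒dual x∈ = rowsIn-dual⇐ G (rowᴹ x) (begin
        rowᴹ x · G ᵀ
          ≈⟨ ·-systematicᵀ (rowᴹ x) ⟩
        x₁ ⊕ x₂ · M ᵀ
          ≈⟨ ⊕-congˡ x₁ (≋.trans (·-congʳ (M ᵀ) (systematic-rowsIn⇒ (rowᴹ x) (λ _ → x∈))) (·-assoc x₁ M (M ᵀ))) ⟩
        x₁ ⊕ x₁ · gram M
          ≈⟨ Y⊕Y·K≋𝟎 x₁ gram-condition ⟩
        𝟎 ∎) zero
        where open ≋-Reasoning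
      dual⇒code : Dual R (SystematicCode M) x → SystematicCode M x
      dual⇒code x⊥ =
        systematic-rowsIn⇐ (rowᴹ x) (⊕-inverseˡ-unique (Y⊕Y·K≋𝟎 x₂ cogram-condition) x₁M⊕x₂MᵀM≋𝟎) zero
        where
        open ≋-Reasoning
        x₁M⊕x₂MᵀM≋𝟎 : x₁ · M ⊕ x₂ · gram (M ᵀ) ≋ 𝟎
        x₁M⊕x₂MᵀM≋𝟎 = begin
          x₁ · M ⊕ x₂ · (M ᵀ · M)
            ≈⟨ ⊕-cong ≋.refl (·-assoc x₂ (M ᵀ) M) ⟨
          x₁ · M ⊕ (x₂ · M ᵀ) · M
            ≈⟨ ·-distribʳ x₁ (x₂ · M ᵀ) M ⟨
          (x₁ ⊕ x₂ · M ᵀ) · M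
            ≈⟨ ·-congʳ M (≋.trans (≋.sym (·-systematicᵀ (rowᴹ x))) (rowsIn-dual⇒ G (rowᴹ x) (λ _ → x⊥))) ⟩
          𝟎 · M
            ≈⟨ ·-zeroˡ M ⟩
          𝟎 ∎

  characteristic2⇒x+x≈0 : HasCharacteristic2 R → ∀ x → x + x ≈ 0#
  characteristic2⇒x+x≈0 (_ , 1+1≈0) x = begin
    x + x              ≈⟨ +-cong (*-identityʳ x) (*-identityʳ x) ⟨
    x * 1# + x * 1#    ≈⟨ distribˡ x 1# 1# ⟨
    x * (1# + 1#)      ≈⟨ *-congˡ 1+1≈0 ⟩
    x * 0#             ≈⟨ zeroʳ x ⟩
    0#                 ∎
    where open SetoidReasoning setoid

  module _ (x+x≈0 : ∀ x → x + x ≈ 0#) where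

    gram-⊕ : (Y C : Matrix R m n) → IsSymmetric (Y · C ᵀ) → gram C ≋ 𝟎 → gram (Y ⊕ C) ≋ gram Y
    gram-⊕ Y C YCᵀ-sym CCᵀ≋𝟎 i j = begin
      gram (Y ⊕ C) i j
        ≈⟨ expand i j ⟩
      (gram Y i j + (C · Y ᵀ) i j) + ((Y · C ᵀ) i j + gram C i j)
        ≈⟨ +-cong (+-congˡ cross) (+-congˡ (CCᵀ≋𝟎 i j)) ⟩
      (gram Y i j + (Y · C ᵀ) i j) + ((Y · C ᵀ) i j + 0#)
        ≈⟨ +-congˡ (+-identityʳ _) ⟩
      (gram Y i j + (Y · C ᵀ) i j) + (Y · C ᵀ) i j
        ≈⟨ +-assoc _ _ _ ⟩
      gram Y i j + ((Y · C ᵀ) i j + (Y · C ᵀ) i j)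
        ≈⟨ +-congˡ (x+x≈0 _) ⟩
      gram Y i j + 0#
        ≈⟨ +-identityʳ _ ⟩
      gram Y i j ∎
      where
      open SetoidReasoning setoid
      expand : gram (Y ⊕ C) ≋ (gram Y ⊕ C · Y ᵀ) ⊕ (Y · C ᵀ ⊕ gram C)
      expand = ≋.trans (·-distribˡ (Y ⊕ C) (Y ᵀ) (C ᵀ)) (⊕-cong (·-distribʳ Y C (Y ᵀ)) (·-distribʳ Y C (C ᵀ)))
      cross : (C · Y ᵀ) i j ≈ (Y · C ᵀ) i j
      cross = trans (sym (transpose-· Y (C ᵀ) i j)) (YCᵀ-sym i j)

    anticommutator-⊕ : (X Y C : Matrix R n n) → X · C ≋ C · X → X · (Y ⊕ C) ⊕ (Y ⊕ C) · X ≋ X · Y ⊕ Y · X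
    anticommutator-⊕ X Y C XC≋CX i j = begin
      (X · (Y ⊕ C) ⊕ (Y ⊕ C) · X) i j
        ≈⟨ ⊕-cong (·-distribˡ X Y C) (·-distribʳ Y C X) i j ⟩
      ((X · Y) i j + (X · C) i j) + ((Y · X) i j + (C · X) i j)
        ≈⟨ interchange _ _ _ _ ⟩
      ((X · Y) i j + (Y · X) i j) + ((X · C) i j + (C · X) i j)
        ≈⟨ +-congˡ (trans (+-congˡ (sym (XC≋CX i j))) (x+x≈0 _)) ⟩
      ((X · Y) i j + (Y · X) i j) + 0#
        ≈⟨ +-identityʳ _ ⟩
      (X · Y ⊕ Y · X) i j ∎
      where open SetoidReasoning setoid

    gram-fourBlock-⊕ : (X Y C : Matrix R n n) → IsSymmetric C → X · C ≋ C · X →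
      IsSymmetric (Y · C) → IsSymmetric (Y ᵀ · C) → C · C ≋ 𝟎 →
      gram (fourBlock X (Y ⊕ C)) ≋ gram (fourBlock X Y)
    gram-fourBlock-⊕ X Y C C-sym XC≋CX YC-sym YᵀC-sym CC≋𝟎 =
      ≋.trans (gram-fourBlock X (Y ⊕ C)) (≋.trans (block-cong tl tr bl br) (≋.sym (gram-fourBlock X Y)))
      where
      tl = ⊕-congˡ (gram X)
        (gram-⊕ Y C (symmetric-resp (·-congˡ Y (≋.sym C-sym)) YC-sym) (≋.trans (·-congˡ C C-sym) CC≋𝟎))
      tr = anticommutator-⊕ X Y C XC≋CX
      transpose-anticommutator : ∀ Z → (X · Z ⊕ Z · X) ᵀ ≋ Z ᵀ · X ᵀ ⊕ X ᵀ · Z ᵀ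
      transpose-anticommutator Z = ⊕-cong (transpose-· X Z) (transpose-· Z X)
      bl = ≋.trans (≋.sym (transpose-anticommutator (Y ⊕ C))) (≋.trans (ᵀ-cong tr) (transpose-anticommutator Y))
      br = ⊕-cong (gram-⊕ (Y ᵀ) (C ᵀ) YᵀC-sym (≋.trans (·-congʳ C C-sym) CC≋𝟎)) ≋.refl

  -- Circulant and reverse circulant matrices

  module _ {k : ℕ} where
    -- IsReverseCirculant R X is RowShift 1 X by definition, and IsCirculant R X is
    -- RowShift k X up to predMod≡rotate.
    RowShift : ℕ → Matrix R (suc k) (suc k) → Set ℓ
    RowShift s X = ∀ (i : Fin k) j → X (suc i) j ≈ X (inject₁ i) (rotate s j)

    rowShift⇒rowFormula : ∀ {s X} → RowShift s X → ∀ i j → X i j ≈ X zero (rotate (toℕ i ℕ.* s) j)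
    rowShift⇒rowFormula {s} {X} shift = <-weakInduction (λ i → ∀ j → X i j ≈ X zero (rotate (toℕ i ℕ.* s) j))
      (λ j → reflexive (≡.cong (X zero) (≡.sym (rotate-zero j))))
      (λ i IH j → trans (shift i j) (trans (IH (rotate s j)) (reflexive (≡.cong (X zero) (shifted i j)))))
      where
      shifted : ∀ i j → rotate (toℕ (inject₁ i) ℕ.* s) (rotate s j) ≡ rotate (toℕ (suc i) ℕ.* s) j
      shifted i j = ≡.trans (rotate-rotate (toℕ (inject₁ i) ℕ.* s) s j)
        (≡.cong (λ t → rotate t j) (≡.trans (≡.cong (λ t → t ℕ.* s ℕ.+ s) (toℕ-inject₁ i)) (ℕₚ.+-comm _ s)))

    rowShift⇒cyclic : ∀ {s X} → RowShift s X → ∀ i j → X (rotate 1 i) j ≈ X i (rotate s j)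
    rowShift⇒cyclic {s} {X} shift i j with Top.view i
    ... | Top.‵inject₁ i′ = trans (reflexive (≡.cong (λ r → X r j) (rotate-inject₁ i′))) (shift i′ j)
    ... | Top.‵fromℕ = begin
      X (rotate 1 (fromℕ k)) j
        ≡⟨ ≡.cong (λ r → X r j) rotate-fromℕ ⟩
      X zero j
        ≡⟨ ≡.cong (X zero) (rotate-cancel (k ℕ.* s) s s j wraps) ⟨
      X zero (rotate (k ℕ.* s) (rotate s j))
        ≡⟨ ≡.cong (λ t → X zero (rotate (t ℕ.* s) (rotate s j))) (toℕ-fromℕ k) ⟨
      X zero (rotate (toℕ (fromℕ k) ℕ.* s) (rotate s j))
        ≈⟨ rowShift⇒rowFormula {s} {X} shift (fromℕ k) (rotate s j) ⟨
      X (fromℕ k) (rotate s j) ∎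
      where
      open SetoidReasoning setoid
      wraps : k ℕ.* s ℕ.+ s ≡ s ℕ.* suc k
      wraps = ≡.trans (ℕₚ.+-comm (k ℕ.* s) s)
        (≡.trans (≡.cong (s ℕ.+_) (ℕₚ.*-comm k s)) (≡.sym (ℕₚ.*-suc s k)))

    reverseCirculant⇒symmetric : ∀ {X} → IsReverseCirculant R X → IsSymmetric X
    reverseCirculant⇒symmetric {X} rc i j = begin
      X j i                                  ≈⟨ rowShift⇒rowFormula {1} {X} rc j i ⟩
      X zero (rotate (toℕ j ℕ.* 1) i)        ≡⟨ ≡.cong (λ t → X zero (t mod suc k)) (sum-swap (toℕ j) (toℕ i)) ⟩
      X zero (rotate (toℕ i ℕ.* 1) j)        ≈⟨ rowShift⇒rowFormula {1} {X} rc i j ⟨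
      X i j                                  ∎
      where
      open SetoidReasoning setoid
      sum-swap : ∀ a b → a ℕ.* 1 ℕ.+ b ≡ b ℕ.* 1 ℕ.+ a
      sum-swap a b = ≡.trans (≡.cong (ℕ._+ b) (ℕₚ.*-identityʳ a))
        (≡.trans (ℕₚ.+-comm a b) (≡.cong (ℕ._+ a) (≡.sym (ℕₚ.*-identityʳ b))))

    circulant⇒rowShift : ∀ {X} → IsCirculant R X → RowShift k X
    circulant⇒rowShift {X} circ i j = trans (circ i j) (reflexive (≡.cong (X (inject₁ i)) (predMod≡rotate j)))

    circulant-transpose : ∀ {X} → IsCirculant R X → IsCirculant R (X ᵀ)
    circulant-transpose {X} circ i j = begin
      X j (suc i)
        ≡⟨ ≡.cong₂ X (rotate-1∘rotate-k j) (rotate-inject₁ i) ⟨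
      X (rotate 1 (rotate k j)) (rotate 1 (inject₁ i))
        ≈⟨ rowShift⇒cyclic {k} {X} (circulant⇒rowShift {X} circ) (rotate k j) (rotate 1 (inject₁ i)) ⟩
      X (rotate k j) (rotate k (rotate 1 (inject₁ i)))
        ≡⟨ ≡.cong₂ X (≡.sym (predMod≡rotate j)) (rotate-k∘rotate-1 (inject₁ i)) ⟩
      X (predMod j) (inject₁ i) ∎
      where open SetoidReasoning setoid

    circulant·reverseCirculant : ∀ {B C} → IsCirculant R B → IsReverseCirculant R C → IsReverseCirculant R (B · C)
    circulant·reverseCirculant {B} {C} circ rc i j = begin
      ∑ (λ l → B (suc i) l * C l j)
        ≈⟨ ∑-rotate (λ l → B (suc i) l * C l j) ⟩
      ∑ (λ l → B (suc i) (rotate 1 l) * C (rotate 1 l) j)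
        ≈⟨ ∑-cong {suc k} (λ l →
             *-cong (circulant⇒rowShift {B} circ i (rotate 1 l)) (rowShift⇒cyclic {1} {C} rc l j)) ⟩
      ∑ (λ l → B (inject₁ i) (rotate k (rotate 1 l)) * C l (rotate 1 j))
        ≈⟨ ∑-≡ {suc k} (λ l → ≡.cong (λ r → B (inject₁ i) r * C l (rotate 1 j)) (rotate-k∘rotate-1 l)) ⟩
      ∑ (λ l → B (inject₁ i) l * C l (rotate 1 j)) ∎
      where open SetoidReasoning setoid

corollary3p3 : ∀ {c ℓ} (R : CommutativeRing c ℓ) → IsFrobenius R → HasCharacteristic2 R →
    (k : ℕ) → (A B : Matrix R (suc k) (suc k)) →
    IsCirculant R A → IsCirculant R B →
    IsSelfDual R (GeneratedCode R (DCGenerator R A B (transpose R B) (transpose R A))) →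
    (C : Matrix R (suc k) (suc k)) → IsReverseCirculant R C →
    _≈ᴹ_ R (_*ᴹ_ R A C) (_*ᴹ_ R C A) → _≈ᴹ_ R (_*ᴹ_ R C C) (zeroᴹ R) →
    IsSelfDual R (GeneratedCode R
      (DCGenerator R A (_+ᴹ_ R B C) (_+ᴹ_ R (transpose R B) C) (transpose R A)))
corollary3p3 R _ char2 k A B _ B-circ selfDual C C-rc AC≋CA CC≋𝟎 =
  selfDual⇐ M′ (≋.trans (⊕-congˡ (𝐈 _) gram-M′) gram-condition)
               (≋.trans (⊕-congˡ (𝐈 _) gram-M′ᵀ) cogram-condition)
  where
  open Matrices R
  M′ = block R A (B ⊕ C) (B ᵀ ⊕ C) (A ᵀ)
  C-sym = reverseCirculant⇒symmetric {X = C} C-rc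
  perturb : ∀ X → X · C ≋ C · X → gram (fourBlock X (B ⊕ C)) ≋ gram (fourBlock X B)
  perturb X XC≋CX = gram-fourBlock-⊕ (characteristic2⇒x+x≈0 char2) X B C C-sym XC≋CX
    (reverseCirculant⇒symmetric {X = B · C} (circulant·reverseCirculant {B = B} {C} B-circ C-rc))
    (reverseCirculant⇒symmetric {X = B ᵀ · C}
      (circulant·reverseCirculant {B = B ᵀ} {C} (circulant-transpose {X = B} B-circ) C-rc))
    CC≋𝟎
  gram-condition = proj₁ (selfDual⇒ (fourBlock A B) selfDual)
  cogram-condition = proj₂ (selfDual⇒ (fourBlock A B) selfDual)
  gram-M′ : gram M′ ≋ gram (fourBlock A B)
  gram-M′ = ≋.trans (gram-cong (fourBlock-⊕ A B C C-sym)) (perturb A AC≋CA)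
  gram-M′ᵀ : gram (M′ ᵀ) ≋ gram (fourBlock A B ᵀ)
  gram-M′ᵀ = begin
    gram (M′ ᵀ)
      ≈⟨ gram-cong (≋.trans (ᵀ-cong (fourBlock-⊕ A B C C-sym)) (transpose-fourBlock A (B ⊕ C))) ⟩
    gram (fourBlock (A ᵀ) (B ⊕ C))
      ≈⟨ perturb (A ᵀ) (commute-transpose {X = A} C-sym AC≋CA) ⟩
    gram (fourBlock (A ᵀ) B)
      ≈⟨ gram-cong (transpose-fourBlock A B) ⟨
    gram (fourBlock A B ᵀ) ∎
    where open ≋-Reasoning
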